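{- Let $A$ be a finite alphabet, $\widetilde{A}=\{\tilde a\mid a\in A\}$ a disjoint copy of $A$, $\Sigma$ a finite alphabet, $h:(A\cup\widetilde{A})^*\to\Sigma^*$ a homomorphism, $R\subseteq A^*$ a regular language, and $S=\{w\,\widetilde{w}^r\mid w\in A^*\}$. Let $L=h(R\widetilde{A}^*\cap S)$. There is an effective procedure which, given $h$ and $R$, returns an elementary bounded language $B\subseteq\Sigma^*$ such that $\Pi(L\cap B)=\Pi(L)$.
   Context: For $w=b_1\cdots b_m\in A^*$, $\widetilde{w}^r$ denotes $\tilde b_m\cdots\tilde b_1$ (the reverse of $w$ written in the copy alphabet). A homomorphism is a map $h$ with $h(\varepsilon)=\varepsilon$ and $h(uv)=h(u)h(v)$, extended setwise to languages. Fix a linear order on $\Sigma=\{a_1,\dots,a_p\}$; the Parikh image $\Pi:\Sigma^*\to\mathbb{N}^p$ is defined by $\Pi(a_i)=\mathbf{e}_i$, $\Pi(\varepsilon)=\mathbf{0}$, $\Pi(uv)=\Pi(u)+\Pi(v)$, and $\Pi(L)=\{\Pi(w)\mid w\in L\}$ for languages. An elementary bounded language over $\Sigma$ is a language of the form $w_1^*\cdots w_k^*$ with $w_1,\dots,w_k\in\Sigma^*$. -}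

module Defs where

open import Data.Nat using (ℕ; zero; suc; _+_)
open import Data.Fin using (Fin; _≟_)
open import Data.Bool using (Bool; true; false; T; if_then_else_)
open import Data.List using (List; []; _∷_; _++_; map; reverse; concatMap; foldl)
open import Data.Vec using (Vec; replicate; zipWith; tabulate)
open import Data.Sum using (_⊎_; inj₁; inj₂)
open import Data.Product using (Σ; ∃; _×_; _,_)
open import Relation.Nullary using (does)
open import Relation.Binary.PropositionalEquality using (_≡_)
open import Data.List.Relation.Unary.All using (All)

-- The alphabet A ∪ Ã, with A = Fin n: inj₁ a is a, inj₂ a is ã.
Letter : ℕ → Set
Letter n = Fin n ⊎ Fin n

Hom : ℕ → ℕ → Set
Hom n p = Letter n → List (Fin p)

applyHom : ∀ {n p} → Hom n p → List (Letter n) → List (Fin p)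
applyHom h = concatMap h

record DFA (n : ℕ) : Set where
  field
    states : ℕ
    start  : Fin states
    δ      : Fin states → Fin n → Fin states
    final  : Fin states → Bool

runDFA : ∀ {n} (M : DFA n) → Fin (DFA.states M) → List (Fin n) → Fin (DFA.states M)
runDFA M q [] = q
runDFA M q (a ∷ w) = runDFA M (DFA.δ M q a) w

Accepts : ∀ {n} → DFA n → List (Fin n) → Set
Accepts M w = T (DFA.final M (runDFA M (DFA.start M) w))

tildeRev : ∀ {n} → List (Fin n) → List (Letter n)
tildeRev w = reverse (map inj₂ w)

InRÃ* : ∀ {n} → DFA n → List (Letter n) → Set
InRÃ* R u = ∃ λ x → ∃ λ y → Accepts R x × u ≡ map inj₁ x ++ map inj₂ y

InS : ∀ {n} → List (Letter n) → Set
InS u = ∃ λ w → u ≡ map inj₁ w ++ tildeRev w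

InL : ∀ {n p} → Hom n p → DFA n → List (Fin p) → Set
InL h R v = ∃ λ u → (InRÃ* R u × InS u) × applyHom h u ≡ v

pow : ∀ {p} → List (Fin p) → ℕ → List (Fin p)
pow w zero = []
pow w (suc k) = w ++ pow w k

-- Membership in the elementary bounded language w₁* ⋯ w_k* given by [w₁, …, w_k].
InBounded : ∀ {p} → List (List (Fin p)) → List (Fin p) → Set
InBounded [] v = v ≡ []
InBounded (w ∷ ws) v = ∃ λ k → ∃ λ v' → v ≡ pow w k ++ v' × InBounded ws v'

unit : ∀ {p} → Fin p → Vec ℕ p
unit i = tabulate λ j → if does (i ≟ j) then 1 else 0

parikh : ∀ {p} → List (Fin p) → Vec ℕ p
parikh [] = replicate _ 0
parikh (a ∷ w) = zipWith _+_ (unit a) (parikh w)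

module Submission where

-- Since h(w w̃ʳ) = h₁(w) h₂(wʳ) for the restrictions h₁, h₂ of h to A and Ã, and permutations preserve
-- Parikh images, it suffices to find an elementary bounded language C over A such that every w ∈ R has
-- a permutation in R ∩ C: then B = h₁(C) h₂(Cʳ) works. Fix a DFA for R with N states. A word of length
-- at least N(N+1) contains a nonempty loop of length at most N all of whose states were visited before
-- it. Removing such loops keeps the final state and the set of visited states, and ends in a path p
-- shorter than N(N+1); reinserting every removed loop at its state on p gives a permutation of w with the
-- same run that lies in (S L)^|p| S, where S = s₁* ⋯ s_k* for the words sᵢ of length at most N and
-- L = a₁* ⋯ aₙ* for the letters.

open import Defs
open import Data.Bool using (T)
open import Data.Fin using (Fin) renaming (_≟_ to _≟ᶠ_)
open import Data.List
  using (List; []; _∷_; _++_; [_]; map; reverse; concat; concatMap; mapMaybe; filter; length; allFin; take; drop)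
open import Data.List.Properties
  using (++-assoc; ++-identityʳ; ++-monoid; length-++; length-take; length-tabulate; take++drop≡id; concatMap-++;
         reverse-++; unfold-reverse; reverse-map; map-∘; mapMaybe-++; mapMaybeIsInj₁∘mapInj₁; mapMaybeIsInj₁∘mapInj₂;
         filter-notAll)
open import Data.List.Membership.Propositional using (_∈_; _∉_)
open import Data.List.Membership.Propositional.Properties using (∈-map⁺; ∈-concatMap⁺; ∈-filter⁺; ∈-allFin)
open import Data.List.Relation.Binary.Permutation.Propositional as ↭ using (_↭_; ↭-refl; ↭-sym; ↭-trans; ↭-reflexive)
open import Data.List.Relation.Binary.Permutation.Propositional.Properties using (++⁺ˡ; ++⁺ʳ; ++⁺; shifts; map⁺; ↭-reverse)
open import Data.List.Relation.Binary.Sublist.Heterogeneous using ([]; _∷_; _∷ʳ_)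
open import Data.List.Relation.Binary.Sublist.Propositional using (⊆-refl) renaming (_⊆_ to _⊑_)
import Data.List.Relation.Binary.Sublist.Propositional.Properties as Sublist
open import Data.List.Relation.Binary.Subset.Propositional using (_⊆_)
open import Data.List.Relation.Binary.Subset.Propositional.Properties using (⊆-trans; ∈-∷⁺ʳ)
open import Data.List.Relation.Unary.All using (All; []; _∷_)
open import Data.List.Relation.Unary.All.Properties using (all-filter)
open import Data.List.Relation.Unary.Any using (here; there)
import Data.List.Relation.Unary.Any as Any
open import Data.Nat using (ℕ; zero; suc; _+_; _*_; _≤_; _<_; _≤?_; _<?_; z≤n; s≤s)
open import Data.Nat.Induction using (<-wellFounded)
open import Data.Nat.Properties
  using (≤-trans; ≤-reflexive; <⇒≤; <-≤-trans; ≮⇒≥; ≰⇒>; m≤n⇒m≤1+n; m<n⇒m<1+n; m<1+n⇒m≤n; m≤n⇒m<n∨m≡n;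
         m≤n⇒m⊓n≡m;
         +-cancelˡ-≤; +-monoˡ-≤; +-monoʳ-<; +-suc; +-assoc; +-comm; m≤m+n; m≤n+m; m<n+m; m≤m*n; *-suc)
open import Data.Product using (Σ; ∃; ∃₂; _×_; _,_)
open import Data.Sum using (_⊎_; inj₁; inj₂; isInj₁)
open import Data.Vec using (Vec; zipWith)
open import Data.Vec.Properties using (zipWith-assoc; zipWith-comm)
open import Function using (_∘_)
open import Induction.WellFounded using (Acc; acc)
open import Relation.Nullary using (¬_; Dec; yes; no; contradiction)
open import Relation.Binary.PropositionalEquality using (_≡_; refl; sym; trans; cong; cong₂; subst; subst₂; module ≡-Reasoning)

open ≡-Reasoning

-- Powers and elementary bounded languages

pow-++-comm : ∀ {p} (w : List (Fin p)) k → pow w k ++ w ≡ w ++ pow w k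
pow-++-comm w zero = sym (++-identityʳ w)
pow-++-comm w (suc k) = trans (++-assoc w (pow w k) w) (cong (w ++_) (pow-++-comm w k))

reverse-pow : ∀ {p} (w : List (Fin p)) k → reverse (pow w k) ≡ pow (reverse w) k
reverse-pow w zero = refl
reverse-pow w (suc k) = begin
  reverse (w ++ pow w k)               ≡⟨ reverse-++ w (pow w k) ⟩
  reverse (pow w k) ++ reverse w       ≡⟨ cong (_++ reverse w) (reverse-pow w k) ⟩
  pow (reverse w) k ++ reverse w       ≡⟨ pow-++-comm (reverse w) k ⟩
  reverse w ++ pow (reverse w) k       ∎

concatMap-pow : ∀ {p q} (f : Fin p → List (Fin q)) w k → concatMap f (pow w k) ≡ pow (concatMap f w) k
concatMap-pow f w zero = refl
concatMap-pow f w (suc k) = trans (concatMap-++ f w (pow w k)) (cong (concatMap f w ++_) (concatMap-pow f w k))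

InBounded-[] : ∀ {p} (ws : List (List (Fin p))) → InBounded ws []
InBounded-[] [] = refl
InBounded-[] (w ∷ ws) = 0 , [] , refl , InBounded-[] ws

InBounded-++ : ∀ {p} {ws vs : List (List (Fin p))} {u v} → InBounded ws u → InBounded vs v → InBounded (ws ++ vs) (u ++ v)
InBounded-++ {ws = []} refl v∈vs = v∈vs
InBounded-++ {ws = w ∷ ws} {v = v} (k , u , refl , u∈ws) v∈vs = k , u ++ v , ++-assoc (pow w k) u v , InBounded-++ u∈ws v∈vs

InBounded-∈ : ∀ {p} {ws : List (List (Fin p))} {w} → w ∈ ws → InBounded ws w
InBounded-∈ {ws = w ∷ ws} (here refl) = 1 , [] , sym (trans (++-identityʳ _) (++-identityʳ w)) , InBounded-[] ws
InBounded-∈ {ws = _ ∷ _} (there w∈ws) = 0 , _ , refl , InBounded-∈ w∈ws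

InBounded-mono : ∀ {p} {ws vs : List (List (Fin p))} {v} → ws ⊑ vs → InBounded ws v → InBounded vs v
InBounded-mono [] refl = refl
InBounded-mono (_ ∷ʳ ws⊑vs) v∈ws = 0 , _ , refl , InBounded-mono ws⊑vs v∈ws
InBounded-mono (refl ∷ ws⊑vs) (k , v , eq , v∈ws) = k , v , eq , InBounded-mono ws⊑vs v∈ws

InBounded-insert : ∀ {p} {ws : List (List (Fin p))} {y v} → y ∈ ws → InBounded ws v →
                   ∃ λ v' → InBounded ws v' × v' ↭ y ++ v
InBounded-insert {y = y} (here refl) (k , v , refl , v∈ws) =
  pow y (suc k) ++ v , (suc k , v , refl , v∈ws) , ↭-reflexive (++-assoc y (pow y k) v)
InBounded-insert {ws = w ∷ _} {y} (there y∈ws) (k , v , refl , v∈ws) with InBounded-insert y∈ws v∈ws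
... | v' , v'∈ws , v'↭ = pow w k ++ v' , (k , v' , refl , v'∈ws) , ↭-trans (++⁺ˡ (pow w k) v'↭) (shifts (pow w k) y)

InBounded-concatMap : ∀ {p q} (f : Fin p → List (Fin q)) {ws v} → InBounded ws v → InBounded (map (concatMap f) ws) (concatMap f v)
InBounded-concatMap f {[]} refl = refl
InBounded-concatMap f {w ∷ ws} (k , v , refl , v∈ws) =
  k , concatMap f v , trans (concatMap-++ f (pow w k) v) (cong (_++ concatMap f v) (concatMap-pow f w k)) ,
  InBounded-concatMap f v∈ws

InBounded-reverse : ∀ {p} {ws : List (List (Fin p))} {v} → InBounded ws v → InBounded (reverse (map reverse ws)) (reverse v)
InBounded-reverse {ws = []} refl = refl
InBounded-reverse {ws = w ∷ ws} (k , v , refl , v∈ws) =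
  subst₂ InBounded (sym (unfold-reverse (reverse w) (map reverse ws))) (sym reversed)
    (InBounded-++ (InBounded-reverse v∈ws) (k , [] , sym (++-identityʳ _) , refl))
  where
  reversed : reverse (pow w k ++ v) ≡ reverse v ++ pow (reverse w) k
  reversed = trans (reverse-++ (pow w k) v) (cong (reverse v ++_) (reverse-pow w k))

zipWith-+-leftComm : ∀ {m} (u v r : Vec ℕ m) → zipWith _+_ u (zipWith _+_ v r) ≡ zipWith _+_ v (zipWith _+_ u r)
zipWith-+-leftComm u v r = begin
  zipWith _+_ u (zipWith _+_ v r)  ≡⟨ sym (zipWith-assoc +-assoc u v r) ⟩
  zipWith _+_ (zipWith _+_ u v) r  ≡⟨ cong (λ s → zipWith _+_ s r) (zipWith-comm +-comm u v) ⟩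
  zipWith _+_ (zipWith _+_ v u) r  ≡⟨ zipWith-assoc +-assoc v u r ⟩
  zipWith _+_ v (zipWith _+_ u r)  ∎

parikh-↭ : ∀ {p} {xs ys : List (Fin p)} → xs ↭ ys → parikh xs ≡ parikh ys
parikh-↭ ↭.refl = refl
parikh-↭ (↭.prep x xs↭ys) = cong (zipWith _+_ (unit x)) (parikh-↭ xs↭ys)
parikh-↭ (↭.swap x y xs↭ys) =
  trans (zipWith-+-leftComm (unit x) (unit y) _) (cong (zipWith _+_ (unit y) ∘ zipWith _+_ (unit x)) (parikh-↭ xs↭ys))
parikh-↭ (↭.trans xs↭ys ys↭zs) = trans (parikh-↭ xs↭ys) (parikh-↭ ys↭zs)

concatMap-↭ : ∀ {A B : Set} (f : A → List B) {xs ys} → xs ↭ ys → concatMap f xs ↭ concatMap f ys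
concatMap-↭ f ↭.refl = ↭-refl
concatMap-↭ f (↭.prep x xs↭ys) = ++⁺ˡ (f x) (concatMap-↭ f xs↭ys)
concatMap-↭ f (↭.swap x y xs↭ys) = ↭-trans (shifts (f x) (f y)) (++⁺ˡ (f y) (++⁺ˡ (f x) (concatMap-↭ f xs↭ys)))
concatMap-↭ f (↭.trans xs↭ys ys↭zs) = ↭-trans (concatMap-↭ f xs↭ys) (concatMap-↭ f ys↭zs)

m+n≤o+1+p⇒n≤p : ∀ {m n o p} → o < m → m + n ≤ o + suc p → n ≤ p
m+n≤o+1+p⇒n≤p {m} {n} {o} {p} o<m m+n≤ =
  +-cancelˡ-≤ m n p (≤-trans m+n≤ (≤-trans (≤-reflexive (+-suc o p)) (+-monoˡ-≤ p o<m)))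

length-++-++ : ∀ {A : Set} (x y z : List A) → length (x ++ y ++ z) ≡ length x + (length y + length z)
length-++-++ x y z = trans (length-++ x) (cong (length x +_) (length-++ y))

length-infix : ∀ {A : Set} (x y z : List A) → length y ≤ length (x ++ y ++ z)
length-infix x y z = subst (length y ≤_) (sym (length-++-++ x y z)) (≤-trans (m≤m+n (length y) (length z)) (m≤n+m _ (length x)))

length-removeInfix : ∀ {A : Set} (x y z : List A) → 0 < length y → length (x ++ z) < length (x ++ y ++ z)
length-removeInfix x y z nonempty =
  subst₂ _<_ (sym (length-++ x)) (sym (length-++-++ x y z)) (+-monoʳ-< (length x) (m<n+m (length z) nonempty))

module _ {a p q} {A : Set a} {P : A → Set p} {Q : A → Set q}
         (P? : ∀ x → Dec (P x)) (Q? : ∀ x → Dec (Q x))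
         (P⇒Q : ∀ {x} → P x → Q x) where

  length-filter-mono : ∀ xs → length (filter P? xs) ≤ length (filter Q? xs)
  length-filter-mono [] = z≤n
  length-filter-mono (x ∷ xs) with P? x | Q? x
  ... | yes _  | yes _   = s≤s (length-filter-mono xs)
  ... | yes px | no ¬qx  = contradiction (P⇒Q px) ¬qx
  ... | no _   | yes _   = m≤n⇒m≤1+n (length-filter-mono xs)
  ... | no _   | no _    = length-filter-mono xs

  length-filter-strict : ∀ {x xs} → x ∈ xs → Q x → ¬ P x → length (filter P? xs) < length (filter Q? xs)
  length-filter-strict {xs = y ∷ xs} (here refl) qy ¬py with P? y | Q? y
  ... | yes py | _      = contradiction py ¬py
  ... | no _   | yes _  = s≤s (length-filter-mono xs)
  ... | no _   | no ¬qy = contradiction qy ¬qy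
  length-filter-strict {xs = y ∷ xs} (there x∈xs) qx ¬px with P? y | Q? y
  ... | yes _  | yes _  = s≤s (length-filter-strict x∈xs qx ¬px)
  ... | yes py | no ¬qy = contradiction (P⇒Q py) ¬qy
  ... | no _   | yes _  = m<n⇒m<1+n (length-filter-strict x∈xs qx ¬px)
  ... | no _   | no _   = length-filter-strict x∈xs qx ¬px

-- The words w w̃ʳ

mirror : ∀ {n} → List (Fin n) → List (Letter n)
mirror w = map inj₁ w ++ tildeRev w

mirror-split : ∀ {n} (w : List (Fin n)) → mirror w ≡ map inj₁ w ++ map inj₂ (reverse w)
mirror-split w = cong (map inj₁ w ++_) (sym (reverse-map inj₂ w))

map-inj₁-++-injective : ∀ {A B : Set} {x x' : List A} {y y' : List B} →
                        map inj₁ x ++ map inj₂ y ≡ map inj₁ x' ++ map inj₂ y' → x ≡ x'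
map-inj₁-++-injective {x = x} {x'} {y} {y'} eq = begin
  x                                          ≡⟨ sym (lefts x y) ⟩
  mapMaybe isInj₁ (map inj₁ x ++ map inj₂ y)   ≡⟨ cong (mapMaybe isInj₁) eq ⟩
  mapMaybe isInj₁ (map inj₁ x' ++ map inj₂ y') ≡⟨ lefts x' y' ⟩
  x'                                         ∎
  where
  lefts : ∀ x y → mapMaybe isInj₁ (map inj₁ x ++ map inj₂ y) ≡ x
  lefts x y = begin
    mapMaybe isInj₁ (map inj₁ x ++ map inj₂ y)                   ≡⟨ mapMaybe-++ isInj₁ (map inj₁ x) (map inj₂ y) ⟩
    mapMaybe isInj₁ (map inj₁ x) ++ mapMaybe isInj₁ (map inj₂ y) ≡⟨ cong₂ _++_ (mapMaybeIsInj₁∘mapInj₁ x) (mapMaybeIsInj₁∘mapInj₂ y) ⟩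
    x ++ []                                                      ≡⟨ ++-identityʳ x ⟩
    x                                                            ∎

mirror-↭ : ∀ {n} {w w' : List (Fin n)} → w' ↭ w → mirror w' ↭ mirror w
mirror-↭ {w = w} {w'} w'↭w =
  ++⁺ (map⁺ inj₁ w'↭w)
      (↭-trans (↭-reverse (map inj₂ w')) (↭-trans (map⁺ inj₂ w'↭w) (↭-sym (↭-reverse (map inj₂ w)))))

applyHom-mirror : ∀ {n p} (h : Hom n p) w →
                  applyHom h (mirror w) ≡ concatMap (h ∘ inj₁) w ++ concatMap (h ∘ inj₂) (reverse w)
applyHom-mirror h w = begin
  concatMap h (mirror w)                                               ≡⟨ cong (concatMap h) (mirror-split w) ⟩
  concatMap h (map inj₁ w ++ map inj₂ (reverse w))                     ≡⟨ concatMap-++ h (map inj₁ w) _ ⟩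
  concatMap h (map inj₁ w) ++ concatMap h (map inj₂ (reverse w))       ≡⟨ cong₂ (λ u v → concat u ++ concat v)
                                                                            (sym (map-∘ w)) (sym (map-∘ (reverse w))) ⟩
  concatMap (h ∘ inj₁) w ++ concatMap (h ∘ inj₂) (reverse w)           ∎

InL⇒mirror : ∀ {n p} (h : Hom n p) (R : DFA n) {v} → InL h R v → ∃ λ w → Accepts R w × applyHom h (mirror w) ≡ v
InL⇒mirror h R (u , ((x , y , x∈R , u≡) , (w , u≡mirror)) , hu≡v) =
  w , subst (Accepts R) x≡w x∈R , trans (cong (applyHom h) (sym u≡mirror)) hu≡v
  where
  x≡w : x ≡ w
  x≡w = map-inj₁-++-injective (trans (sym u≡) (trans u≡mirror (mirror-split w)))

mirror∈L : ∀ {n p} (h : Hom n p) (R : DFA n) {w} → Accepts R w → InL h R (applyHom h (mirror w))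
mirror∈L h R {w} w∈R = mirror w , ((w , reverse w , w∈R , mirror-split w) , (w , refl)) , refl

shortWords : ∀ n → ℕ → List (List (Fin n))
shortWords n zero = [ [] ]
shortWords n (suc k) = [] ∷ concatMap (λ a → map (a ∷_) (shortWords n k)) (allFin n)

∈-shortWords : ∀ {n k} (y : List (Fin n)) → length y ≤ k → y ∈ shortWords n k
∈-shortWords {k = zero} [] _ = here refl
∈-shortWords {k = suc k} [] _ = here refl
∈-shortWords {n} {suc k} (a ∷ y) (s≤s |y|≤k) =
  there (∈-concatMap⁺ (λ b → map (b ∷_) (shortWords n k))
          (Any.map (λ { refl → ∈-map⁺ (a ∷_) (∈-shortWords y |y|≤k) }) (∈-allFin a)))

-- Runs of a deterministic automaton

module Runs {n : ℕ} (M : DFA n) where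

  open DFA M using (δ)
  open import Data.List.Membership.DecPropositional (_≟ᶠ_ {DFA.states M}) using (_∈?_; _∉?_)
  open import Algebra.Solver.Monoid (++-monoid (Fin n)) using (solve; _⊜_; _⊕_)

  N : ℕ
  N = DFA.states M

  State : Set
  State = Fin N

  Word : Set
  Word = List (Fin n)

  run : State → Word → State
  run = runDFA M

  run-++ : ∀ q (u v : Word) → run q (u ++ v) ≡ run (run q u) v
  run-++ q [] v = refl
  run-++ q (a ∷ u) v = run-++ (δ q a) u v

  run-pow : ∀ s c k → run s c ≡ s → run s (pow c k) ≡ s
  run-pow s c zero closed = refl
  run-pow s c (suc k) closed = begin
    run s (c ++ pow c k)       ≡⟨ run-++ s c (pow c k) ⟩
    run (run s c) (pow c k)    ≡⟨ cong (λ t → run t (pow c k)) closed ⟩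
    run s (pow c k)            ≡⟨ run-pow s c k closed ⟩
    s                          ∎

  run-loops : ∀ {s ws v} → All (λ c → run s c ≡ s) ws → InBounded ws v → run s v ≡ s
  run-loops [] refl = refl
  run-loops {s} {c ∷ _} (closed ∷ loops) (k , v , refl , v∈ws) = begin
    run s (pow c k ++ v)       ≡⟨ run-++ s (pow c k) v ⟩
    run (run s (pow c k)) v    ≡⟨ cong (λ t → run t v) (run-pow s c k closed) ⟩
    run s v                    ≡⟨ run-loops loops v∈ws ⟩
    s                          ∎

  visited : State → Word → List State
  visited q [] = [ q ]
  visited q (a ∷ w) = q ∷ visited (δ q a) w

  run∈visited : ∀ q u → run q u ∈ visited q u
  run∈visited q [] = here refl
  run∈visited q (a ∷ u) = there (run∈visited (δ q a) u)

  visited-++⁺ˡ : ∀ q u v → visited q u ⊆ visited q (u ++ v)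
  visited-++⁺ˡ q [] [] t∈ = t∈
  visited-++⁺ˡ q [] (_ ∷ _) (here refl) = here refl
  visited-++⁺ˡ q (a ∷ u) v (here refl) = here refl
  visited-++⁺ˡ q (a ∷ u) v (there t∈) = there (visited-++⁺ˡ (δ q a) u v t∈)

  visited-++⁺ʳ : ∀ q u v → visited (run q u) v ⊆ visited q (u ++ v)
  visited-++⁺ʳ q [] v t∈ = t∈
  visited-++⁺ʳ q (a ∷ u) v t∈ = there (visited-++⁺ʳ (δ q a) u v t∈)

  visited-infix : ∀ q x y z → visited (run q x) y ⊆ visited q (x ++ y ++ z)
  visited-infix q x y z = ⊆-trans (visited-++⁺ˡ (run q x) y z) (visited-++⁺ʳ q x (y ++ z))

  visited-++⁻ : ∀ {t} q u v → t ∈ visited q (u ++ v) → t ∈ visited q u ⊎ t ∈ visited (run q u) v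
  visited-++⁻ q [] v t∈ = inj₂ t∈
  visited-++⁻ q (a ∷ u) v (here refl) = inj₁ (here refl)
  visited-++⁻ q (a ∷ u) v (there t∈) with visited-++⁻ (δ q a) u v t∈
  ... | inj₁ t∈u = inj₁ (there t∈u)
  ... | inj₂ t∈v = inj₂ t∈v

  ∈visited⇒prefix : ∀ {t} q u → t ∈ visited q u → ∃₂ λ u₁ u₂ → u ≡ u₁ ++ u₂ × run q u₁ ≡ t
  ∈visited⇒prefix q [] (here refl) = [] , [] , refl , refl
  ∈visited⇒prefix q (a ∷ u) (here refl) = [] , a ∷ u , refl , refl
  ∈visited⇒prefix q (a ∷ u) (there t∈) with ∈visited⇒prefix (δ q a) u t∈
  ... | u₁ , u₂ , refl , reached = a ∷ u₁ , u₂ , refl , reached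

  unvisited : List State → List State
  unvisited V = filter (_∉? V) (allFin N)

  unvisited<N : ∀ {t V} → t ∈ V → length (unvisited V) < N
  unvisited<N {t} {V} t∈V =
    subst (length (unvisited V) <_) (length-tabulate (λ i → i))
      (filter-notAll (_∉? V) (allFin N) (Any.map (λ { refl t∉V → t∉V t∈V }) (∈-allFin t)))

  unvisited-shrinks : ∀ {V W t} → V ⊆ W → t ∈ W → t ∉ V → length (unvisited W) < length (unvisited V)
  unvisited-shrinks {V} {W} {t} V⊆W t∈W t∉V =
    length-filter-strict (_∉? W) (_∉? V) (λ t∉W t∈V → t∉W (V⊆W t∈V)) (∈-allFin t) t∉V (λ t∉W → t∉W t∈W)

  record Loop (s : State) (u : Word) : Set where
    constructor loop
    field
      x y z : Word
      split : u ≡ x ++ y ++ z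
      nonempty : 0 < length y
      closed : run (run s x) y ≡ run s x

  loop-at-revisit : ∀ s p₁ p₂ a rest → run s p₁ ≡ δ (run s (p₁ ++ p₂)) a → Loop s ((p₁ ++ p₂) ++ a ∷ rest)
  loop-at-revisit s p₁ p₂ a rest revisit = loop p₁ (p₂ ++ [ a ]) rest
    (solve 4 (λ p₁ p₂ a rest → (p₁ ⊕ p₂) ⊕ a ⊕ rest ⊜ p₁ ⊕ (p₂ ⊕ a) ⊕ rest) refl p₁ p₂ [ a ] rest)
    (subst (0 <_) (sym (length-++ p₂)) (m≤n+m 1 (length p₂)))
    (begin
      run (run s p₁) (p₂ ++ [ a ])  ≡⟨ run-++ (run s p₁) p₂ [ a ] ⟩
      δ (run (run s p₁) p₂) a       ≡⟨ cong (λ t → δ t a) (sym (run-++ s p₁ p₂)) ⟩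
      δ (run s (p₁ ++ p₂)) a        ≡⟨ sym revisit ⟩
      run s p₁                      ∎)

  -- Pigeonhole: each step that does not close a loop reaches a new state.
  loop-scan : ∀ s pre rest → length (unvisited (visited s pre)) < length rest → Loop s (pre ++ rest)
  loop-scan s pre (a ∷ rest) budget with δ (run s pre) a ∈? visited s pre
  ... | yes seen with ∈visited⇒prefix s pre seen
  ...   | p₁ , p₂ , refl , revisit = loop-at-revisit s p₁ p₂ a rest revisit
  loop-scan s pre (a ∷ rest) budget | no fresh =
    subst (Loop s) (++-assoc pre [ a ] rest) (loop-scan s (pre ++ [ a ]) rest (<-≤-trans shrunk (m<1+n⇒m≤n budget)))
    where
    shrunk : length (unvisited (visited s (pre ++ [ a ]))) < length (unvisited (visited s pre))
    shrunk = unvisited-shrinks (visited-++⁺ˡ s pre [ a ])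
               (subst (_∈ visited s (pre ++ [ a ])) (run-++ s pre [ a ]) (run∈visited s (pre ++ [ a ]))) fresh

  short-loop : ∀ s u → N ≤ length u → Σ (Loop s u) λ ℓ → length (Loop.y ℓ) ≤ N
  short-loop s u N≤|u| = extend (loop-scan s [] (take N u) (subst (_ <_) (sym |prefix|) (unvisited<N (here refl))))
    where
    |prefix| : length (take N u) ≡ N
    |prefix| = trans (length-take N u) (m≤n⇒m⊓n≡m N≤|u|)

    extend : Loop s (take N u) → Σ (Loop s u) λ ℓ → length (Loop.y ℓ) ≤ N
    extend (loop x y z split nonempty closed) =
      loop x y (z ++ drop N u) extended nonempty closed ,
      subst (length y ≤_) (trans (cong length (sym split)) |prefix|) (length-infix x y z)
      where
      extended : u ≡ x ++ y ++ z ++ drop N u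
      extended = begin
        u                             ≡⟨ sym (take++drop≡id N u) ⟩
        take N u ++ drop N u          ≡⟨ cong (_++ drop N u) split ⟩
        (x ++ y ++ z) ++ drop N u     ≡⟨ solve 4 (λ x y z r → (x ⊕ y ⊕ z) ⊕ r ⊜ x ⊕ y ⊕ z ⊕ r) refl x y z (drop N u) ⟩
        x ++ y ++ z ++ drop N u       ∎

  record RemovableLoop (q : State) (w : Word) : Set where
    field
      x y z : Word
      split : w ≡ x ++ y ++ z
      nonempty : 0 < length y
      short : length y ≤ N
      closed : run (run q x) y ≡ run q x
      revisits : visited (run q x) y ⊆ visited q x

  removableLoop-within : ∀ q pre u rest → visited (run q pre) u ⊆ visited q pre → N ≤ length u →
                         RemovableLoop q (pre ++ u ++ rest)
  removableLoop-within q pre u rest within N≤|u| with short-loop (run q pre) u N≤|u|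
  ... | loop u₁ u₂ u₃ refl nonempty closed , short = record
    { x = pre ++ u₁ ; y = u₂ ; z = u₃ ++ rest
    ; split = solve 5 (λ p u₁ u₂ u₃ r → p ⊕ (u₁ ⊕ u₂ ⊕ u₃) ⊕ r ⊜ (p ⊕ u₁) ⊕ u₂ ⊕ u₃ ⊕ r) refl pre u₁ u₂ u₃ rest
    ; nonempty = nonempty
    ; short = short
    ; closed = subst (λ t → run t u₂ ≡ t) (sym entry) closed
    ; revisits = ⊆-trans (subst (λ t → visited t u₂ ⊆ visited (run q pre) u) (sym entry)
                                  (visited-infix (run q pre) u₁ u₂ u₃))
                         (⊆-trans within (visited-++⁺ˡ q pre u₁))
    }
    where
    entry : run q (pre ++ u₁) ≡ run (run q pre) u₁
    entry = run-++ q pre u₁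

  data Span (V : List State) (s : State) : Word → Set where
    stays : ∀ {u} → visited s u ⊆ V → Span V s u
    leaves : ∀ {u} a w → visited s u ⊆ V → δ (run s u) a ∉ V → Span V s (u ++ a ∷ w)

  span : ∀ V s w → s ∈ V → Span V s w
  span V s [] s∈V = stays (∈-∷⁺ʳ s∈V (λ ()))
  span V s (a ∷ w) s∈V with δ s a ∈? V
  ... | no out = leaves {u = []} a w (∈-∷⁺ʳ s∈V (λ ())) out
  ... | yes next∈V with span V (δ s a) w next∈V
  ...   | stays within = stays (∈-∷⁺ʳ s∈V within)
  ...   | leaves b w' within out = leaves {u = a ∷ _} b w' (∈-∷⁺ʳ s∈V within) out

  -- Each of the at most m states not yet visited costs fewer than N letters to reach, and N letters
  -- read among visited states close a loop.
  removableLoop-from : ∀ q m pre w → length (unvisited (visited q pre)) ≤ m → N * suc m ≤ length w →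
                       RemovableLoop q (pre ++ w)
  removableLoop-from q m pre w unvisited≤m budget with span (visited q pre) (run q pre) w (run∈visited q pre)
  ... | stays within =
    subst (RemovableLoop q) (cong (pre ++_) (++-identityʳ w))
      (removableLoop-within q pre w [] within (≤-trans (m≤m*n N (suc m)) budget))
  ... | leaves {u} a w' within fresh with N ≤? length u
  ...   | yes N≤|u| = removableLoop-within q pre u (a ∷ w') within N≤|u|
  ...   | no N≰|u| = descend m unvisited≤m budget
    where
    pre' : Word
    pre' = pre ++ u ++ [ a ]

    reached : run q pre' ≡ δ (run (run q pre) u) a
    reached = trans (run-++ q pre (u ++ [ a ])) (run-++ (run q pre) u [ a ])

    shrunk : length (unvisited (visited q pre')) < length (unvisited (visited q pre))
    shrunk = unvisited-shrinks (visited-++⁺ˡ q pre (u ++ [ a ])) (subst (_∈ visited q pre') reached (run∈visited q pre')) fresh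

    descend : ∀ m → length (unvisited (visited q pre)) ≤ m → N * suc m ≤ length (u ++ a ∷ w') →
              RemovableLoop q (pre ++ u ++ a ∷ w')
    descend zero unvisited≤0 _ = contradiction (<-≤-trans shrunk unvisited≤0) (λ ())
    descend (suc m) unvisited≤1+m budget =
      subst (RemovableLoop q) (solve 4 (λ p u a w → (p ⊕ u ⊕ a) ⊕ w ⊜ p ⊕ u ⊕ a ⊕ w) refl pre u [ a ] w')
        (removableLoop-from q m pre' w' (m<1+n⇒m≤n (<-≤-trans shrunk unvisited≤1+m))
          (m+n≤o+1+p⇒n≤p (≰⇒> N≰|u|) (subst₂ _≤_ (*-suc N (suc m)) (length-++ u) budget)))

  removableLoop : ∀ q w → N * suc N ≤ length w → RemovableLoop q w
  removableLoop q w = removableLoop-from q N [] w (<⇒≤ (unvisited<N (here refl)))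

  run-removeLoop : ∀ q x y z → run (run q x) y ≡ run q x → run q (x ++ z) ≡ run q (x ++ y ++ z)
  run-removeLoop q x y z closed = begin
    run q (x ++ z)                 ≡⟨ run-++ q x z ⟩
    run (run q x) z                ≡⟨ cong (λ t → run t z) (sym closed) ⟩
    run (run (run q x) y) z        ≡⟨ sym (run-++ (run q x) y z) ⟩
    run (run q x) (y ++ z)         ≡⟨ sym (run-++ q x (y ++ z)) ⟩
    run q (x ++ y ++ z)            ∎

  visited-removeLoop : ∀ q x y z → run (run q x) y ≡ run q x → visited (run q x) y ⊆ visited q x →
                       visited q (x ++ y ++ z) ⊆ visited q (x ++ z)
  visited-removeLoop q x y z closed revisits t∈ with visited-++⁻ q x (y ++ z) t∈
  ... | inj₁ t∈x = visited-++⁺ˡ q x z t∈x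
  ... | inj₂ t∈yz with visited-++⁻ (run q x) y z t∈yz
  ...   | inj₁ t∈y = visited-++⁺ˡ q x z (revisits t∈y)
  ...   | inj₂ t∈z = visited-++⁺ʳ q x z (subst (λ s → _ ∈ visited s z) closed t∈z)

  loopsAt : State → List Word
  loopsAt s = filter (λ c → run s c ≟ᶠ s) (shortWords n N)

  ∈-loopsAt : ∀ {s y} → run s y ≡ s → length y ≤ N → y ∈ loopsAt s
  ∈-loopsAt {y = y} closed short = ∈-filter⁺ (λ c → run _ c ≟ᶠ _) (∈-shortWords y short) closed

  run-loopsAt : ∀ {s l} → InBounded (loopsAt s) l → run s l ≡ s
  run-loopsAt = run-loops (all-filter (λ c → run _ c ≟ᶠ _) (shortWords n N))

  -- Pumped s p w: w arises from the path p by inserting, at every state t visited on the way,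
  -- a word of the bounded language spanned by the short loops at t.
  data Pumped (s : State) : Word → Word → Set where
    end  : ∀ {l} → InBounded (loopsAt s) l → Pumped s [] l
    step : ∀ {l a p w} → InBounded (loopsAt s) l → Pumped (δ s a) p w → Pumped s (a ∷ p) (l ++ a ∷ w)

  run-Pumped : ∀ {s p w} → Pumped s p w → run s w ≡ run s p
  run-Pumped (end l∈loops) = run-loopsAt l∈loops
  run-Pumped {s} (step {l} {a} {p} {w} l∈loops pumped) = begin
    run s (l ++ a ∷ w)         ≡⟨ run-++ s l (a ∷ w) ⟩
    run (run s l) (a ∷ w)      ≡⟨ cong (λ t → run t (a ∷ w)) (run-loopsAt l∈loops) ⟩
    run s (a ∷ w)              ≡⟨ run-Pumped pumped ⟩
    run s (a ∷ p)              ∎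

  Pumped-refl : ∀ s p → Pumped s p p
  Pumped-refl s [] = end (InBounded-[] (loopsAt s))
  Pumped-refl s (a ∷ p) = step (InBounded-[] (loopsAt s)) (Pumped-refl (δ s a) p)

  Pumped-insert : ∀ {s p w t y} → Pumped s p w → t ∈ visited s p → run t y ≡ t → length y ≤ N →
                  ∃ λ w' → Pumped s p w' × w' ↭ y ++ w
  Pumped-insert (end l∈loops) (here refl) closed short with InBounded-insert (∈-loopsAt closed short) l∈loops
  ... | l' , l'∈loops , l'↭ = l' , end l'∈loops , l'↭
  Pumped-insert {y = y} (step {l} {a} {w = w} l∈loops pumped) (here refl) closed short
    with InBounded-insert (∈-loopsAt closed short) l∈loops
  ... | l' , l'∈loops , l'↭ =
    l' ++ a ∷ w , step l'∈loops pumped , ↭-trans (++⁺ʳ (a ∷ w) l'↭) (↭-reflexive (++-assoc y l (a ∷ w)))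
  Pumped-insert {y = y} (step {l} {a} l∈loops pumped) (there t∈) closed short with Pumped-insert pumped t∈ closed short
  ... | w' , pumped' , w'↭ = l ++ a ∷ w' , step l∈loops pumped' ,
    ↭-trans (++⁺ˡ l (↭.prep a w'↭)) (↭-trans (++⁺ˡ l (shifts [ a ] y)) (shifts l y))

  letters : List Word
  letters = map [_] (allFin n)

  blocks : ℕ → List Word
  blocks zero = shortWords n N
  blocks (suc m) = shortWords n N ++ letters ++ blocks m

  blocks-⊑ : ∀ {m} k → m ≤ k → blocks m ⊑ blocks k
  blocks-⊑ k m≤k with m≤n⇒m<n∨m≡n m≤k
  ... | inj₂ refl = ⊆-refl
  blocks-⊑ (suc k) _ | inj₁ m<1+k = Sublist.++⁺ˡ (shortWords n N) (Sublist.++⁺ˡ letters (blocks-⊑ k (m<1+n⇒m≤n m<1+k)))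

  Pumped-bounded : ∀ {s p w} → Pumped s p w → InBounded (blocks (length p)) w
  Pumped-bounded {s} (end l∈loops) = InBounded-mono (Sublist.filter-⊆ (λ c → run s c ≟ᶠ s) _) l∈loops
  Pumped-bounded {s} (step {a = a} l∈loops pumped) =
    InBounded-++ {ws = shortWords n N} (InBounded-mono (Sublist.filter-⊆ (λ c → run s c ≟ᶠ s) _) l∈loops)
      (InBounded-++ {ws = letters} (InBounded-∈ (∈-map⁺ [_] (∈-allFin a))) (Pumped-bounded pumped))

  K : ℕ
  K = N * suc N

  record Skeleton (q : State) (w : Word) : Set where
    field
      path : Word
      short : length path < K
      same-end : run q path ≡ run q w
      covers : visited q w ⊆ visited q path
      pumped : Word
      pumps : Pumped q path pumped
      permutes : pumped ↭ w

  Skeleton-reinsert : ∀ q x y z → run (run q x) y ≡ run q x → visited (run q x) y ⊆ visited q x → length y ≤ N →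
                      Skeleton q (x ++ z) → Skeleton q (x ++ y ++ z)
  Skeleton-reinsert q x y z closed revisits short S
    with Pumped-insert (Skeleton.pumps S) (Skeleton.covers S (visited-++⁺ˡ q x z (run∈visited q x))) closed short
  ... | w' , pumps' , w'↭ = record
    { path = path
    ; short = Skeleton.short S
    ; same-end = trans same-end (run-removeLoop q x y z closed)
    ; covers = covers ∘ visited-removeLoop q x y z closed revisits
    ; pumped = w'
    ; pumps = pumps'
    ; permutes = ↭-trans w'↭ (↭-trans (++⁺ˡ y permutes) (shifts y x))
    }
    where open Skeleton S using (path; same-end; covers; permutes)

  skeleton : ∀ q w → Acc _<_ (length w) → Skeleton q w
  skeleton q w (acc shorter) with length w <? K
  ... | yes short = record
    { path = w ; short = short ; same-end = refl ; covers = λ t∈ → t∈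
    ; pumped = w ; pumps = Pumped-refl q w ; permutes = ↭-refl }
  ... | no long with removableLoop q w (≮⇒≥ long)
  ... | record { x = x ; y = y ; z = z ; split = refl ; nonempty = nonempty ; short = short ; closed = closed ; revisits = revisits } =
    Skeleton-reinsert q x y z closed revisits short (skeleton q (x ++ z) (shorter (length-removeInfix x y z nonempty)))

  boundedPermutation : ∀ q w → ∃ λ w' → (InBounded (blocks K) w' × run q w' ≡ run q w) × w' ↭ w
  boundedPermutation q w =
    pumped , (InBounded-mono (blocks-⊑ K (<⇒≤ short)) (Pumped-bounded pumps) , trans (run-Pumped pumps) same-end) , permutes
    where open Skeleton (skeleton q w (<-wellFounded (length w)))

boundedLanguage : ∀ {n p} → Hom n p → DFA n → List (List (Fin p))
boundedLanguage h R = map (concatMap (h ∘ inj₁)) C ++ map (concatMap (h ∘ inj₂)) (reverse (map reverse C))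
  where
  open Runs R using (blocks; K)

  C : List (List (Fin _))
  C = blocks K

InL⇒boundedPermutation : ∀ {n p} (h : Hom n p) (R : DFA n) {v} → InL h R v →
  ∃ λ v' → (InL h R v' × InBounded (boundedLanguage h R) v') × parikh v' ≡ parikh v
InL⇒boundedPermutation h R v∈L with InL⇒mirror h R v∈L
... | w , w∈R , refl with Runs.boundedPermutation R (DFA.start R) w
... | w' , (w'∈C , same-end) , w'↭w =
  applyHom h (mirror w') ,
  (mirror∈L h R {w'} (subst (T ∘ DFA.final R) (sym same-end) w∈R) ,
   subst (InBounded (boundedLanguage h R)) (sym (applyHom-mirror h w'))
     (InBounded-++ (InBounded-concatMap (h ∘ inj₁) w'∈C) (InBounded-concatMap (h ∘ inj₂) (InBounded-reverse w'∈C)))) ,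
  parikh-↭ (concatMap-↭ h (mirror-↭ w'↭w))

proposition3 : ∀ {n p : ℕ} (h : Hom n p) (R : DFA n) →
    Σ (List (List (Fin p))) λ B →
      (v : Vec ℕ p) →
        ((∃ λ w → InL h R w × parikh w ≡ v) → (∃ λ w → (InL h R w × InBounded B w) × parikh w ≡ v))
        × ((∃ λ w → (InL h R w × InBounded B w) × parikh w ≡ v) → (∃ λ w → InL h R w × parikh w ≡ v))
proposition3 h R = B , λ v → restrict , forget
  where
  B : List (List (Fin _))
  B = boundedLanguage h R

  restrict : ∀ {v} → (∃ λ w → InL h R w × parikh w ≡ v) → ∃ λ w → (InL h R w × InBounded B w) × parikh w ≡ v
  restrict (w , w∈L , refl) = InL⇒boundedPermutation h R w∈L

  forget : ∀ {v} → (∃ λ w → (InL h R w × InBounded B w) × parikh w ≡ v) → ∃ λ w → InL h R w × parikh w ≡ v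
  forget (w , (w∈L , _) , Πw≡v) = w , w∈L , Πw≡v
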